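{- Let $\alpha$ be a composition with irreducible factorisation $\alpha=\alpha_1\circ\alpha_2\circ\dots\circ\alpha_k$. Then $\alpha$ is symmetric if and only if $\alpha_i$ is symmetric for every $i\in\{1,\dots,k\}$. Moreover, if $\alpha$ is asymmetric, then there is an $\ell\in\{1,\dots,k\}$ such that $\alpha_\ell$ is asymmetric and $\alpha_i$ is symmetric for all $i>\ell$; for this $\ell$, $\alpha<\alpha^*$ if and only if $\alpha_\ell<\alpha_\ell^*$.
   Context: A composition $\alpha=(a_1,\dots,a_k)$ of a positive integer $m$ is a list of positive integers with $a_1+\dots+a_k=m$; its length is $l(\alpha)=k$ and its size is $|\alpha|=m$. For $\alpha=(a_1,\dots,a_k)$ and $\beta=(b_1,\dots,b_\ell)$, the concatenation is $\alpha\cdot\beta=(a_1,\dots,a_k,b_1,\dots,b_\ell)$ and the near concatenation is $\alpha\odot\beta=(a_1,\dots,a_{k-1},a_k+b_1,b_2,\dots,b_\ell)$. Write $\beta^{\odot n}=\beta\odot\dots\odot\beta$ ($n$ copies). The composition of compositions is $\alpha\circ\beta=\beta^{\odot a_1}\cdot\beta^{\odot a_2}\cdots\beta^{\odot a_k}$; this operation is associative with neutral element $(1)$, and $(\alpha\circ\beta)^*=\alpha^*\circ\beta^*$. The reversal of $\alpha=(a_1,\dots,a_k)$ is $\alpha^*=(a_k,\dots,a_1)$, and $\alpha$ is symmetric if $\alpha=\alpha^*$, asymmetric otherwise. A factorisation $\alpha=\beta\circ\gamma$ is trivial if (1) one of $\beta,\gamma$ is $(1)$, or (2) $\beta$ and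 $\gamma$ both have length $1$, or (3) $\beta$ and $\gamma$ both have all components equal to $1$. A factorisation $\alpha=\alpha_1\circ\dots\circ\alpha_k$ is irreducible if no $\alpha_i\circ\alpha_{i+1}$ is a trivial factorisation and each $\alpha_i$ admits only trivial factorisations. Every composition has a unique irreducible factorisation. Compositions of the same length are ordered lexicographically: $(a_1,\dots,a_k)<(b_1,\dots,b_k)$ iff for some $s$, $a_s<b_s$ and $a_r=b_r$ for all $r<s$. -}

module Defs where

open import Data.Nat using (ℕ; zero; suc; _+_; _<_)
open import Data.List using (List; []; _∷_; _++_; concatMap; foldr; reverse; length)
open import Data.List.Relation.Unary.All using (All)
open import Data.Product using (_×_)
open import Data.Sum using (_⊎_)
open import Data.Unit using (⊤)
open import Relation.Binary.PropositionalEquality using (_≡_; _≢_)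
open import Relation.Nullary using (¬_)

Composition? : List ℕ → Set
Composition? α = (α ≢ []) × All (λ a → 0 < a) α

infixl 6 _⊙_
_⊙_ : List ℕ → List ℕ → List ℕ
[] ⊙ bs = bs
(a ∷ []) ⊙ [] = a ∷ []
(a ∷ []) ⊙ (b ∷ bs) = (a + b) ∷ bs
(a ∷ a′ ∷ as) ⊙ bs = a ∷ ((a′ ∷ as) ⊙ bs)

-- β^{⊙ n}  (for n ≥ 1; β^{⊙ 0} = [] is never used on compositions)
⊙pow : List ℕ → ℕ → List ℕ
⊙pow β zero = []
⊙pow β (suc n) = β ⊙ ⊙pow β n

infixr 5 _∘ᶜ_
_∘ᶜ_ : List ℕ → List ℕ → List ℕ
α ∘ᶜ β = concatMap (⊙pow β) α

∘-all : List (List ℕ) → List ℕ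
∘-all = foldr _∘ᶜ_ (1 ∷ [])

Symmetric : List ℕ → Set
Symmetric α = reverse α ≡ α

TrivialFact : List ℕ → List ℕ → Set
TrivialFact β γ =
  (β ≡ 1 ∷ [] ⊎ γ ≡ 1 ∷ [])
  ⊎ (length β ≡ 1 × length γ ≡ 1)
  ⊎ (All (_≡ 1) β × All (_≡ 1) γ)

OnlyTrivial : List ℕ → Set
OnlyTrivial α = ∀ β γ → Composition? β → Composition? γ → β ∘ᶜ γ ≡ α → TrivialFact β γ

AdjNonTrivial : List (List ℕ) → Set
AdjNonTrivial (x ∷ y ∷ r) = ¬ TrivialFact x y × AdjNonTrivial (y ∷ r)
AdjNonTrivial _ = ⊤

IrreducibleFact : List ℕ → List (List ℕ) → Set
IrreducibleFact α αs =
  All Composition? αs × ∘-all αs ≡ α × All OnlyTrivial αs × AdjNonTrivial αs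

-- lexicographic strict order (used for lists of equal length)
data _<ₗ_ : List ℕ → List ℕ → Set where
  here  : ∀ {a b as bs} → a < b → (a ∷ as) <ₗ (b ∷ bs)
  there : ∀ {a as bs} → as <ₗ bs → (a ∷ as) <ₗ (a ∷ bs)

-- Reversal is an anti-automorphism of composition: (β ∘ γ)* = β* ∘ γ*.  Comparing
-- β ∘ γ with β* ∘ γ* lexicographically, the inner factor γ wins whenever it is
-- asymmetric, because γ and γ* already differ before their last entry (they have the
-- same sum), so the difference shows up inside the first block γ^{⊙ b₁}.  When γ is
-- symmetric the comparison is decided by the outer factor, since β ↦ β ∘ γ is strictly
-- monotone.  Thus the orientation (ascending, symmetric, descending) of α₁ ∘ … ∘ α_k is
-- that of its last asymmetric factor, or symmetric if there is none.
module Submission where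

open import Defs
open import Data.Nat using (ℕ; zero; suc; _+_; s≤s; z<s) renaming (_<_ to _<ℕ_)
open import Data.Nat.Properties
  using (<-cmp; <-irrefl; <-asym; <⇒≢; +-comm; +-identityʳ; +-assoc; +-monoʳ-<;
         +-cancelˡ-≡; suc-injective; m≤m+n; ≤-trans; _≟_)
open import Data.Nat.ListAction using (sum)
open import Data.Nat.ListAction.Properties using (sum-↭)
open import Data.Fin as Fin using (Fin; _<_)
open import Data.List using (List; []; _∷_; _++_; _∷ʳ_; [_]; length; lookup; reverse)
open import Data.List.Properties
  using (unfold-reverse; reverse-++; reverse-injective; length-reverse;
         ++-identityʳ; ++-conicalˡ; concatMap-++; ≡-dec)
open import Data.List.Membership.Propositional.Properties using (∈-lookup)
open import Data.List.Relation.Unary.All as All using (All; []; _∷_)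
open import Data.List.Relation.Unary.All.Properties using (++⁺)
open import Data.List.Relation.Binary.Permutation.Propositional using (↭-sym)
open import Data.List.Relation.Binary.Permutation.Propositional.Properties
  using (↭-reverse; All-resp-↭)
open import Data.Product using (Σ; ∃; _×_; _,_)
open import Data.Sum using (_⊎_; inj₁; inj₂)
open import Data.Empty using (⊥-elim)
open import Function using (_∘_)
open import Function.Bundles using (_⇔_; mk⇔; Equivalence)
open import Function.Properties.Equivalence using () renaming (trans to ⇔-trans)
open import Relation.Nullary using (¬_; Dec; yes; no)
open import Relation.Binary.PropositionalEquality
  using (_≡_; _≢_; refl; sym; trans; cong; cong₂; subst; subst₂; module ≡-Reasoning)
open import Relation.Binary.Definitions using (tri<; tri≈; tri>)

open Equivalence using (to; from)

Positive : List ℕ → Set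
Positive = All (0 <ℕ_)

private
  variable
    X Y Y′ β β′ γ γ′ : List ℕ

reverse-positive : Positive X → Positive (reverse X)
reverse-positive {X} = All-resp-↭ (↭-sym (↭-reverse X))

sum-reverse : ∀ X → sum (reverse X) ≡ sum X
sum-reverse X = sum-↭ (↭-reverse X)

reverse-≢-[] : X ≢ [] → reverse X ≢ []
reverse-≢-[] X≢[] = X≢[] ∘ reverse-injective

reverse-composition : Composition? X → Composition? (reverse X)
reverse-composition (X≢[] , X⁺) = reverse-≢-[] X≢[] , reverse-positive X⁺

<ₗ-irrefl : ¬ X <ₗ X
<ₗ-irrefl (here a<a) = <-irrefl refl a<a
<ₗ-irrefl (there p) = <ₗ-irrefl p

<ₗ-asym : X <ₗ Y → ¬ Y <ₗ X
<ₗ-asym (here a<b) (here b<a) = <-asym a<b b<a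
<ₗ-asym (here a<a) (there _) = <-irrefl refl a<a
<ₗ-asym (there _) (here a<a) = <-irrefl refl a<a
<ₗ-asym (there p) (there q) = <ₗ-asym p q

<ₗ-trichotomous : ∀ X Y → length X ≡ length Y → X <ₗ Y ⊎ X ≡ Y ⊎ Y <ₗ X
<ₗ-trichotomous [] [] _ = inj₂ (inj₁ refl)
<ₗ-trichotomous (x ∷ X) (y ∷ Y) |X|≡|Y| with <-cmp x y
... | tri< x<y _ _ = inj₁ (here x<y)
... | tri> _ _ y<x = inj₂ (inj₂ (here y<x))
... | tri≈ _ refl _ with <ₗ-trichotomous X Y (suc-injective |X|≡|Y|)
...   | inj₁ X<Y = inj₁ (there X<Y)
...   | inj₂ (inj₁ refl) = inj₂ (inj₁ refl)
...   | inj₂ (inj₂ Y<X) = inj₂ (inj₂ (there Y<X))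

++-monoʳ-<ₗ : ∀ P → Y <ₗ Y′ → (P ++ Y) <ₗ (P ++ Y′)
++-monoʳ-<ₗ [] Y<Y′ = Y<Y′
++-monoʳ-<ₗ (p ∷ P) Y<Y′ = there (++-monoʳ-<ₗ P Y<Y′)

-- X ≺ Y: X <ₗ Y with the first difference strictly before the last entry of X.
data _≺_ : List ℕ → List ℕ → Set where
  here  : ∀ {a b x y xs ys} → a <ℕ b → (a ∷ x ∷ xs) ≺ (b ∷ y ∷ ys)
  there : ∀ {a xs ys} → xs ≺ ys → (a ∷ xs) ≺ (a ∷ ys)

-- A difference in the last entry alone would change the sum.
<ₗ⇒≺ : X <ₗ Y → length X ≡ length Y → sum X ≡ sum Y → X ≺ Y
<ₗ⇒≺ (here {a} {b} {[]} {[]} a<b) _ Σ≡ =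
  ⊥-elim (<⇒≢ a<b (trans (sym (+-identityʳ a)) (trans Σ≡ (+-identityʳ b))))
<ₗ⇒≺ (here {as = _ ∷ _} {_ ∷ _} a<b) _ _ = here a<b
<ₗ⇒≺ (there {a} p) |X|≡|Y| Σ≡ =
  there (<ₗ⇒≺ p (suc-injective |X|≡|Y|) (+-cancelˡ-≡ a _ _ Σ≡))

⊙-identityʳ : ∀ X → X ⊙ [] ≡ X
⊙-identityʳ [] = refl
⊙-identityʳ (x ∷ []) = refl
⊙-identityʳ (x ∷ x′ ∷ X) = cong (x ∷_) (⊙-identityʳ (x′ ∷ X))

⊙-≢-[] : X ≢ [] → X ⊙ Y ≢ []
⊙-≢-[] {[]} X≢[] = ⊥-elim (X≢[] refl)
⊙-≢-[] {x ∷ []} {[]} _ ()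
⊙-≢-[] {x ∷ []} {y ∷ Y} _ ()
⊙-≢-[] {x ∷ x′ ∷ X} _ ()

∷-⊙ : ∀ x → X ≢ [] → (x ∷ X) ⊙ Y ≡ x ∷ (X ⊙ Y)
∷-⊙ {[]} x X≢[] = ⊥-elim (X≢[] refl)
∷-⊙ {_ ∷ _} x _ = refl

⊙-assoc : ∀ X Y Z → (X ⊙ Y) ⊙ Z ≡ X ⊙ (Y ⊙ Z)
⊙-assoc [] Y Z = refl
⊙-assoc (x ∷ []) [] Z = refl
⊙-assoc (x ∷ []) (y ∷ []) [] = refl
⊙-assoc (x ∷ []) (y ∷ []) (z ∷ Z) = cong (_∷ Z) (+-assoc x y z)
⊙-assoc (x ∷ []) (y ∷ y′ ∷ Y) Z = refl
⊙-assoc (x ∷ x′ ∷ X) Y Z =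
  trans (∷-⊙ x (⊙-≢-[] {x′ ∷ X} {Y} λ ())) (cong (x ∷_) (⊙-assoc (x′ ∷ X) Y Z))

⊙-++ : ∀ X {U} W → U ≢ [] → (X ⊙ U) ++ W ≡ X ⊙ (U ++ W)
⊙-++ [] W _ = refl
⊙-++ (x ∷ []) {[]} W U≢[] = ⊥-elim (U≢[] refl)
⊙-++ (x ∷ []) {_ ∷ _} W _ = refl
⊙-++ (x ∷ x′ ∷ X) W U≢[] = cong (x ∷_) (⊙-++ (x′ ∷ X) W U≢[])

++-as-⊙ : ∀ W → X ≢ [] → X ++ W ≡ X ⊙ (0 ∷ W)
++-as-⊙ {[]} W X≢[] = ⊥-elim (X≢[] refl)
++-as-⊙ {x ∷ []} W _ = cong (_∷ W) (sym (+-identityʳ x))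
++-as-⊙ {x ∷ x′ ∷ X} W _ = cong (x ∷_) (++-as-⊙ W λ ())

∷ʳ-⊙ : ∀ P x y Y → (P ∷ʳ x) ⊙ (y ∷ Y) ≡ P ++ (x + y) ∷ Y
∷ʳ-⊙ [] x y Y = refl
∷ʳ-⊙ (p ∷ []) x y Y = refl
∷ʳ-⊙ (p ∷ p′ ∷ P) x y Y = cong (p ∷_) (∷ʳ-⊙ (p′ ∷ P) x y Y)

reverse-⊙ : ∀ X Y → reverse (X ⊙ Y) ≡ reverse Y ⊙ reverse X
reverse-⊙ [] Y = sym (⊙-identityʳ (reverse Y))
reverse-⊙ (x ∷ []) [] = refl
reverse-⊙ (x ∷ []) (y ∷ Y) = begin
  reverse ((x + y) ∷ Y)          ≡⟨ unfold-reverse (x + y) Y ⟩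
  reverse Y ++ [ x + y ]         ≡⟨ cong (λ z → reverse Y ++ [ z ]) (+-comm x y) ⟩
  reverse Y ++ [ y + x ]         ≡⟨ ∷ʳ-⊙ (reverse Y) y x [] ⟨
  (reverse Y ∷ʳ y) ⊙ [ x ]       ≡⟨ cong (_⊙ [ x ]) (unfold-reverse y Y) ⟨
  reverse (y ∷ Y) ⊙ [ x ]        ∎
  where open ≡-Reasoning
reverse-⊙ (x ∷ x′ ∷ X) Y = begin
  reverse (x ∷ ((x′ ∷ X) ⊙ Y))               ≡⟨ unfold-reverse x ((x′ ∷ X) ⊙ Y) ⟩
  reverse ((x′ ∷ X) ⊙ Y) ∷ʳ x                ≡⟨ cong (_∷ʳ x) (reverse-⊙ (x′ ∷ X) Y) ⟩
  (reverse Y ⊙ reverse (x′ ∷ X)) ∷ʳ x        ≡⟨ ⊙-++ (reverse Y) [ x ] (reverse-≢-[] {x′ ∷ X} λ ()) ⟩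
  reverse Y ⊙ (reverse (x′ ∷ X) ∷ʳ x)        ≡⟨ cong (reverse Y ⊙_) (unfold-reverse x (x′ ∷ X)) ⟨
  reverse Y ⊙ reverse (x ∷ x′ ∷ X)           ∎
  where open ≡-Reasoning

⊙-monoʳ-<ₗ : X ≢ [] → Y <ₗ Y′ → (X ⊙ Y) <ₗ (X ⊙ Y′)
⊙-monoʳ-<ₗ {[]} X≢[] _ = ⊥-elim (X≢[] refl)
⊙-monoʳ-<ₗ {x ∷ []} _ (here y<y′) = here (+-monoʳ-< x y<y′)
⊙-monoʳ-<ₗ {x ∷ []} _ (there Y<Y′) = there Y<Y′
⊙-monoʳ-<ₗ {x ∷ x′ ∷ X} _ Y<Y′ = there (⊙-monoʳ-<ₗ (λ ()) Y<Y′)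

≺-⊙-++ : X ≺ Y → ∀ U U′ W W′ → ((X ⊙ U) ++ W) <ₗ ((Y ⊙ U′) ++ W′)
≺-⊙-++ (here x<y) U U′ W W′ = here x<y
≺-⊙-++ (there p@(here _)) U U′ W W′ = there (≺-⊙-++ p U U′ W W′)
≺-⊙-++ (there p@(there _)) U U′ W W′ = there (≺-⊙-++ p U U′ W W′)

⊙-positive : Positive X → Positive Y → Positive (X ⊙ Y)
⊙-positive {[]} _ Y⁺ = Y⁺
⊙-positive {x ∷ []} {[]} X⁺ _ = X⁺
⊙-positive {x ∷ []} {y ∷ Y} (x⁺ ∷ []) (_ ∷ Y⁺) = ≤-trans x⁺ (m≤m+n x y) ∷ Y⁺
⊙-positive {x ∷ x′ ∷ X} (x⁺ ∷ X⁺) Y⁺ = x⁺ ∷ ⊙-positive X⁺ Y⁺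

⊙pow-positive : ∀ n → Positive X → Positive (⊙pow X n)
⊙pow-positive zero _ = []
⊙pow-positive (suc n) X⁺ = ⊙-positive X⁺ (⊙pow-positive n X⁺)

⊙pow-comm : ∀ X n → ⊙pow X n ⊙ X ≡ X ⊙ ⊙pow X n
⊙pow-comm X zero = sym (⊙-identityʳ X)
⊙pow-comm X (suc n) = trans (⊙-assoc X (⊙pow X n) X) (cong (X ⊙_) (⊙pow-comm X n))

reverse-⊙pow : ∀ X n → reverse (⊙pow X n) ≡ ⊙pow (reverse X) n
reverse-⊙pow X zero = refl
reverse-⊙pow X (suc n) = begin
  reverse (X ⊙ ⊙pow X n)                   ≡⟨ reverse-⊙ X (⊙pow X n) ⟩
  reverse (⊙pow X n) ⊙ reverse X           ≡⟨ cong (_⊙ reverse X) (reverse-⊙pow X n) ⟩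
  ⊙pow (reverse X) n ⊙ reverse X           ≡⟨ ⊙pow-comm (reverse X) n ⟩
  reverse X ⊙ ⊙pow (reverse X) n           ∎
  where open ≡-Reasoning

0∷-<ₗ : ∀ {U} W W′ → Positive U → U ≢ [] → (0 ∷ W) <ₗ (U ++ W′)
0∷-<ₗ {[]} _ _ _ U≢[] = ⊥-elim (U≢[] refl)
0∷-<ₗ {_ ∷ _} _ _ (u⁺ ∷ _) _ = here u⁺

-- γ^{⊙a} ++ W = γ^{⊙a} ⊙ (0 ∷ W) and γ^{⊙b} ++ W′ = γ^{⊙a} ⊙ (γ^{⊙(b-a)} ++ W′),
-- whose second argument starts with a positive entry instead of 0.
⊙pow-<ₗ : Composition? γ → ∀ {a b} → 0 <ℕ a → a <ℕ b → ∀ W W′ →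
          (⊙pow γ a ++ W) <ₗ (⊙pow γ b ++ W′)
⊙pow-<ₗ {γ} (γ≢[] , γ⁺) {suc zero} {suc (suc m)} _ _ W W′ =
  subst₂ _<ₗ_
    (trans (sym (++-as-⊙ W γ≢[])) (cong (_++ W) (sym (⊙-identityʳ γ))))
    (sym (⊙-++ γ W′ P≢[]))
    (⊙-monoʳ-<ₗ γ≢[] (0∷-<ₗ W W′ (⊙pow-positive (suc m) γ⁺) P≢[]))
  where P≢[] = ⊙-≢-[] {Y = ⊙pow γ m} γ≢[]
⊙pow-<ₗ {γ} cγ@(γ≢[] , _) {suc (suc k)} {suc (suc j)} _ (s≤s k<j) W W′ =
  subst₂ _<ₗ_
    (sym (⊙-++ γ W (⊙-≢-[] {Y = ⊙pow γ k} γ≢[])))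
    (sym (⊙-++ γ W′ (⊙-≢-[] {Y = ⊙pow γ j} γ≢[])))
    (⊙-monoʳ-<ₗ γ≢[] (⊙pow-<ₗ cγ z<s k<j W W′))
⊙pow-<ₗ _ {suc zero} {suc zero} _ (s≤s ()) _ _
⊙pow-<ₗ _ {suc (suc _)} {suc zero} _ (s≤s ()) _ _

∘ᶜ-positive : ∀ β → Positive γ → Positive (β ∘ᶜ γ)
∘ᶜ-positive [] _ = []
∘ᶜ-positive (b ∷ β) γ⁺ = ++⁺ (⊙pow-positive b γ⁺) (∘ᶜ-positive β γ⁺)

∘ᶜ-composition : Composition? β → Composition? γ → Composition? (β ∘ᶜ γ)
∘ᶜ-composition {[]} (β≢[] , _) _ = ⊥-elim (β≢[] refl)
∘ᶜ-composition {suc b ∷ β} _ (γ≢[] , γ⁺) =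
  ⊙-≢-[] γ≢[] ∘ ++-conicalˡ _ (β ∘ᶜ _) , ∘ᶜ-positive (suc b ∷ β) γ⁺
∘ᶜ-composition {zero ∷ _} (_ , () ∷ _) _

∘-all-composition : ∀ {αs} → All Composition? αs → Composition? (∘-all αs)
∘-all-composition [] = (λ ()) , z<s ∷ []
∘-all-composition (cα ∷ cαs) = ∘ᶜ-composition cα (∘-all-composition cαs)

reverse-∘ᶜ : ∀ β γ → reverse (β ∘ᶜ γ) ≡ reverse β ∘ᶜ reverse γ
reverse-∘ᶜ [] γ = refl
reverse-∘ᶜ (b ∷ β) γ = begin
  reverse (⊙pow γ b ++ (β ∘ᶜ γ))                      ≡⟨ reverse-++ (⊙pow γ b) (β ∘ᶜ γ) ⟩
  reverse (β ∘ᶜ γ) ++ reverse (⊙pow γ b)              ≡⟨ cong₂ _++_ (reverse-∘ᶜ β γ) (reverse-⊙pow γ b) ⟩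
  (reverse β ∘ᶜ reverse γ) ++ ⊙pow (reverse γ) b      ≡⟨ cong ((reverse β ∘ᶜ reverse γ) ++_) (++-identityʳ _) ⟨
  (reverse β ∘ᶜ reverse γ) ++ ([ b ] ∘ᶜ reverse γ)    ≡⟨ concatMap-++ (⊙pow (reverse γ)) (reverse β) [ b ] ⟨
  (reverse β ∷ʳ b) ∘ᶜ reverse γ                       ≡⟨ cong (_∘ᶜ reverse γ) (unfold-reverse b β) ⟨
  reverse (b ∷ β) ∘ᶜ reverse γ                        ∎
  where open ≡-Reasoning

∘ᶜ-monoˡ-<ₗ : Composition? γ → Positive β → β <ₗ β′ → (β ∘ᶜ γ) <ₗ (β′ ∘ᶜ γ)
∘ᶜ-monoˡ-<ₗ {γ} cγ (b⁺ ∷ _) (here {as = β} {β′} b<b′) = ⊙pow-<ₗ cγ b⁺ b<b′ (β ∘ᶜ γ) (β′ ∘ᶜ γ)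
∘ᶜ-monoˡ-<ₗ {γ} cγ (_ ∷ β⁺) (there {b} β<β′) = ++-monoʳ-<ₗ (⊙pow γ b) (∘ᶜ-monoˡ-<ₗ cγ β⁺ β<β′)

∘ᶜ-mono-≺ : Composition? β → Composition? β′ → γ ≺ γ′ → (β ∘ᶜ γ) <ₗ (β′ ∘ᶜ γ′)
∘ᶜ-mono-≺ {[]} (β≢[] , _) _ _ = ⊥-elim (β≢[] refl)
∘ᶜ-mono-≺ {_ ∷ _} {[]} _ (β′≢[] , _) _ = ⊥-elim (β′≢[] refl)
∘ᶜ-mono-≺ {suc b ∷ β} {suc b′ ∷ β′} {γ} {γ′} _ _ γ≺γ′ =
  ≺-⊙-++ γ≺γ′ (⊙pow γ b) (⊙pow γ′ b′) (β ∘ᶜ γ) (β′ ∘ᶜ γ′)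
∘ᶜ-mono-≺ {zero ∷ _} (_ , () ∷ _) _ _
∘ᶜ-mono-≺ {suc _ ∷ _} {zero ∷ _} _ (_ , () ∷ _) _

data Shape : Set where
  ascending symmetric descending : Shape

private
  variable
    s : Shape

Orientation : Shape → List ℕ → Set
Orientation ascending X = X <ₗ reverse X
Orientation symmetric X = Symmetric X
Orientation descending X = reverse X <ₗ X

¬ascending : Symmetric X → ¬ X <ₗ reverse X
¬ascending {X} X* X<X* = <ₗ-irrefl (subst (X <ₗ_) X* X<X*)

¬descending : Symmetric X → ¬ reverse X <ₗ X
¬descending {X} X* X*<X = <ₗ-irrefl (subst (_<ₗ X) X* X*<X)

orientation : ∀ X → ∃ λ s → Orientation s X
orientation X with <ₗ-trichotomous X (reverse X) (sym (length-reverse X))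
... | inj₁ X<X* = ascending , X<X*
... | inj₂ (inj₁ X≡X*) = symmetric , sym X≡X*
... | inj₂ (inj₂ X*<X) = descending , X*<X

orientation-unique : ∀ {s t X} → Orientation s X → Orientation t X → s ≡ t
orientation-unique {ascending}  {ascending}  _ _ = refl
orientation-unique {symmetric}  {symmetric}  _ _ = refl
orientation-unique {descending} {descending} _ _ = refl
orientation-unique {ascending}  {symmetric}  X<X* X* = ⊥-elim (¬ascending X* X<X*)
orientation-unique {symmetric}  {ascending}  X* X<X* = ⊥-elim (¬ascending X* X<X*)
orientation-unique {descending} {symmetric}  X*<X X* = ⊥-elim (¬descending X* X*<X)
orientation-unique {symmetric}  {descending} X* X*<X = ⊥-elim (¬descending X* X*<X)
orientation-unique {ascending}  {descending} X<X* X*<X = ⊥-elim (<ₗ-asym X<X* X*<X)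
orientation-unique {descending} {ascending}  X*<X X<X* = ⊥-elim (<ₗ-asym X<X* X*<X)

orientation-⇔ : (∀ {s} → Orientation s X → Orientation s Y) → Orientation s Y ⇔ Orientation s X
orientation-⇔ {X} {Y} {s} f = mk⇔ reflect f
  where
  reflect : Orientation s Y → Orientation s X
  reflect oY with orientation X
  ... | t , oX = subst (λ u → Orientation u X) (orientation-unique (f oX) oY) oX

orientation-∘ᶜ-symmetricʳ : Composition? β → Composition? γ → Symmetric γ →
                            Orientation s β → Orientation s (β ∘ᶜ γ)
orientation-∘ᶜ-symmetricʳ {β} {γ} {s} (_ , β⁺) cγ γ* = preserve s
  where
  reverse-β∘γ : reverse (β ∘ᶜ γ) ≡ reverse β ∘ᶜ γ
  reverse-β∘γ = trans (reverse-∘ᶜ β γ) (cong (reverse β ∘ᶜ_) γ*)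

  preserve : ∀ s → Orientation s β → Orientation s (β ∘ᶜ γ)
  preserve ascending β<β* =
    subst ((β ∘ᶜ γ) <ₗ_) (sym reverse-β∘γ) (∘ᶜ-monoˡ-<ₗ cγ β⁺ β<β*)
  preserve symmetric β* = trans reverse-β∘γ (cong (_∘ᶜ γ) β*)
  preserve descending β*<β =
    subst (_<ₗ (β ∘ᶜ γ)) (sym reverse-β∘γ) (∘ᶜ-monoˡ-<ₗ cγ (reverse-positive β⁺) β*<β)

orientation-∘ᶜ-asymmetricʳ : Composition? β → Composition? γ → ¬ Symmetric γ →
                             Orientation s γ → Orientation s (β ∘ᶜ γ)
orientation-∘ᶜ-asymmetricʳ {β} {γ} {s} cβ _ γ*≢γ = preserve s
  where
  cβ* : Composition? (reverse β)
  cβ* = reverse-composition cβ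

  |γ*|≡|γ| : length (reverse γ) ≡ length γ
  |γ*|≡|γ| = length-reverse γ

  Σγ*≡Σγ : sum (reverse γ) ≡ sum γ
  Σγ*≡Σγ = sum-reverse γ

  preserve : ∀ s → Orientation s γ → Orientation s (β ∘ᶜ γ)
  preserve ascending γ<γ* =
    subst ((β ∘ᶜ γ) <ₗ_) (sym (reverse-∘ᶜ β γ))
      (∘ᶜ-mono-≺ cβ cβ* (<ₗ⇒≺ γ<γ* (sym |γ*|≡|γ|) (sym Σγ*≡Σγ)))
  preserve symmetric γ* = ⊥-elim (γ*≢γ γ*)
  preserve descending γ*<γ =
    subst (_<ₗ (β ∘ᶜ γ)) (sym (reverse-∘ᶜ β γ))
      (∘ᶜ-mono-≺ cβ* cβ (<ₗ⇒≺ γ*<γ |γ*|≡|γ| Σγ*≡Σγ))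

orientation-∘ᶜ-symmetricʳ-⇔ : Composition? β → Composition? γ → Symmetric γ →
                              Orientation s (β ∘ᶜ γ) ⇔ Orientation s β
orientation-∘ᶜ-symmetricʳ-⇔ cβ cγ γ* = orientation-⇔ (orientation-∘ᶜ-symmetricʳ cβ cγ γ*)

orientation-∘ᶜ-asymmetricʳ-⇔ : Composition? β → Composition? γ → ¬ Symmetric γ →
                               Orientation s (β ∘ᶜ γ) ⇔ Orientation s γ
orientation-∘ᶜ-asymmetricʳ-⇔ cβ cγ γ*≢γ = orientation-⇔ (orientation-∘ᶜ-asymmetricʳ cβ cγ γ*≢γ)

symmetric? : ∀ X → Dec (Symmetric X)
symmetric? X = ≡-dec _≟_ (reverse X) X

symmetric-∘-all : ∀ {αs} → All Composition? αs → Symmetric (∘-all αs) ⇔ All Symmetric αs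
symmetric-∘-all [] = mk⇔ (λ _ → []) (λ _ → refl)
symmetric-∘-all {β ∷ αs} (cβ ∷ cαs) with symmetric? (∘-all αs)
... | yes γ* = mk⇔ (λ α* → to β⇔ α* ∷ to (symmetric-∘-all cαs) γ*) (λ { (β* ∷ _) → from β⇔ β* })
  where
  β⇔ : Symmetric (β ∘ᶜ ∘-all αs) ⇔ Symmetric β
  β⇔ = orientation-∘ᶜ-symmetricʳ-⇔ cβ (∘-all-composition cαs) γ*
... | no γ*≢γ = mk⇔ (λ α* → ⊥-elim (γ*≢γ (to γ⇔ α*)))
                    (λ { (_ ∷ αs*) → ⊥-elim (γ*≢γ (from (symmetric-∘-all cαs) αs*)) })
  where
  γ⇔ : Symmetric (β ∘ᶜ ∘-all αs) ⇔ Symmetric (∘-all αs)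
  γ⇔ = orientation-∘ᶜ-asymmetricʳ-⇔ cβ (∘-all-composition cαs) γ*≢γ

last-asymmetric-factor :
  ∀ {αs} → All Composition? αs → ¬ Symmetric (∘-all αs) →
  Σ (Fin (length αs)) λ ℓ →
    ¬ Symmetric (lookup αs ℓ)
    × (∀ i → ℓ < i → Symmetric (lookup αs i))
    × (Orientation ascending (∘-all αs) ⇔ Orientation ascending (lookup αs ℓ))
last-asymmetric-factor [] α*≢α = ⊥-elim (α*≢α refl)
last-asymmetric-factor {β ∷ αs} (cβ ∷ cαs) α*≢α with symmetric? (∘-all αs)
... | yes γ* = Fin.zero , α*≢α ∘ from (β⇔ {symmetric}) , later-symmetric , β⇔ {ascending}
  where
  β⇔ : ∀ {s} → Orientation s (β ∘ᶜ ∘-all αs) ⇔ Orientation s β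
  β⇔ = orientation-∘ᶜ-symmetricʳ-⇔ cβ (∘-all-composition cαs) γ*

  later-symmetric : ∀ i → Fin.zero {n = length αs} < i → Symmetric (lookup (β ∷ αs) i)
  later-symmetric (Fin.suc i) _ = All.lookup (to (symmetric-∘-all cαs) γ*) (∈-lookup i)
... | no γ*≢γ with last-asymmetric-factor cαs γ*≢γ
...   | ℓ , αℓ*≢αℓ , later-symmetric , γ⇔αℓ =
  Fin.suc ℓ , αℓ*≢αℓ , later-symmetric′ ,
  ⇔-trans (orientation-∘ᶜ-asymmetricʳ-⇔ {s = ascending} cβ (∘-all-composition cαs) γ*≢γ) γ⇔αℓ
  where
  later-symmetric′ : ∀ i → Fin.suc ℓ < i → Symmetric (lookup (β ∷ αs) i)
  later-symmetric′ (Fin.suc i) (s≤s ℓ<i) = later-symmetric i ℓ<i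

lemma3p2 : (α : List ℕ) → Composition? α → (αs : List (List ℕ)) → IrreducibleFact α αs →
    (Symmetric α ⇔ All Symmetric αs)
    × (¬ Symmetric α →
        Σ (Fin (length αs)) λ ℓ →
          ¬ Symmetric (lookup αs ℓ)
          × (∀ i → ℓ < i → Symmetric (lookup αs i))
          × (α <ₗ reverse α ⇔ lookup αs ℓ <ₗ reverse (lookup αs ℓ)))
lemma3p2 .(∘-all αs) _ αs (cαs , refl , _) = symmetric-∘-all cαs , last-asymmetric-factor cαs
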